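{- Let $n\ge 4$ be an even integer and $\Gamma$ a graph of order $n$. Then $|\mathrm{Aut}(F_{n/2}(\Gamma))|\ge 2\,|\mathrm{Aut}(\Gamma)|$.
   Context: All graphs are finite and simple. For a graph $\Gamma$ of order $n$ and an integer $1\le k\le n-1$, the $k$-token graph $F_k(\Gamma)$ has as vertices all $k$-element subsets of $V(\Gamma)$, two of them $A,B$ being adjacent iff their symmetric difference $A\triangle B$ is an edge of $\Gamma$. -}

module Defs where

open import Data.Nat using (ℕ)
open import Data.Bool using (Bool; _xor_)
open import Data.Fin using (Fin)
open import Data.Fin.Subset using (Subset; ⁅_⁆; _∪_; ∣_∣)
open import Data.Vec using (zipWith)
open import Data.Product using (Σ; ∃; ∃₂; _×_; _,_; proj₁)
open import Relation.Nullary using (¬_)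
open import Relation.Binary.Core using (Rel)
open import Relation.Binary.Definitions using (Symmetric; Decidable)
open import Relation.Binary.PropositionalEquality using (_≡_)
open import Function.Bundles using (_↔_; _⇔_; Inverse)
open import Level using (0ℓ)

record Graph (V : Set) : Set₁ where
  field
    Adj    : Rel V 0ℓ
    sym    : Symmetric Adj
    irrefl : ∀ x → ¬ Adj x x
    dec    : Decidable Adj

GraphOfOrder : ℕ → Set₁
GraphOfOrder n = Graph (Fin n)

Aut : {V : Set} → Rel V 0ℓ → Set
Aut {V} E = Σ (V ↔ V) λ σ →
  ∀ x y → E x y ⇔ E (Inverse.to σ x) (Inverse.to σ y)

SameAut : {V : Set} (E : Rel V 0ℓ) → Aut E → Aut E → Set
SameAut {V} E σ τ = ∀ (x : V) → Inverse.to (proj₁ σ) x ≡ Inverse.to (proj₁ τ) x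

_△_ : {n : ℕ} → Subset n → Subset n → Subset n
A △ B = zipWith _xor_ A B

TokenVertex : ℕ → ℕ → Set
TokenVertex n k = Σ (Subset n) λ A → ∣ A ∣ ≡ k

TokenAdj : {n : ℕ} (Γ : GraphOfOrder n) (k : ℕ) → Rel (TokenVertex n k) 0ℓ
TokenAdj Γ k (A , _) (B , _) =
  ∃₂ λ i j → Graph.Adj Γ i j × (A △ B ≡ ⁅ i ⁆ ∪ ⁅ j ⁆)

-- |Aut(E')| ≥ 2 |Aut(E)| : there is an injection Bool × Aut Γ → Aut Γ'
-- (automorphisms compared pointwise).
AtLeastTwice : {V W : Set} → Rel W 0ℓ → Rel V 0ℓ → Set
AtLeastTwice {V} {W} E' E = Σ (Bool × Aut E → Aut E') λ f →
  ∀ b c σ τ → SameAut E' (f (b , σ)) (f (c , τ)) → (b ≡ c) × SameAut E σ τ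

-- Every automorphism σ of Γ acts on F_m(Γ) by A ↦ σ(A), and since n = 2m the
-- complement A ↦ V ∖ A is an automorphism of F_m(Γ) too, as it preserves
-- symmetric differences. The resulting 2|Aut Γ| automorphisms A ↦ σ(A) and
-- A ↦ V ∖ σ(A) are pairwise distinct: if two of them coincide then, with
-- y = τ⁻¹(σ x), membership of x and of y in every m-set differ by a fixed
-- boolean twist, and comparing an m-set containing x and y with one containing
-- x but not y (possible as 2 ≤ m < n) forces x = y and equal twists.

module Submission where

open import Defs
open import Data.Nat using (ℕ; _≤_; _*_)
open import Data.Nat.Base using (zero; suc; _+_; _∸_; _<_; z≤n; s≤s)
open import Data.Nat.Properties
  using (≡-irrelevant; +-identityʳ; m+n∸m≡n; m<m+n; <⇒≤; +-0-commutativeMonoid)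
open import Data.Bool.Base using (Bool; true; false; not; _xor_; _∨_; if_then_else_)
open import Data.Bool.Properties using (not-injective; not-involutive; xor-comm; xor-annihilates-not)
open import Data.Fin.Base using (Fin; zero; suc; punchOut)
open import Data.Fin.Patterns using (0F; 1F)
open import Data.Fin.Properties using (_≟_; punchIn-punchOut)
open import Data.Fin.Permutation
  using (Permutation′; _⟨$⟩ʳ_; _⟨$⟩ˡ_; inverseˡ; inverseʳ; flip; insert; insert-punchIn; id)
open import Data.Fin.Subset using (Subset; inside; outside; ⁅_⁆; _∪_; ∣_∣; ∁; ⊥)
open import Data.Fin.Subset.Properties using (∣⊥∣≡0; ∣∁p∣≡n∸∣p∣)
open import Data.Vec.Base using ([]; _∷_; lookup; tabulate; zipWith)
open import Data.Vec.Properties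
  using (lookup∘tabulate; lookup-map; lookup-zipWith; lookup-replicate; map-∘; map-cong; map-id)
open import Data.Vec.Relation.Binary.Pointwise.Extensional using (ext; Pointwise-≡⇒≡)
open import Data.Product.Base using (Σ; _×_; _,_; proj₁; proj₂)
open import Relation.Nullary using (yes; no; does; contradiction)
open import Relation.Nullary.Decidable using (does-⇔)
open import Relation.Binary.Core using (Rel)
open import Relation.Binary.PropositionalEquality
open import Function.Bundles using (_↔_; Inverse; Equivalence; mk↔ₛ′; mk⇔)
open import Function.Construct.Composition using (_↔-∘_; _⇔-∘_)
open import Level using (0ℓ)
open import Algebra.Properties.CommutativeMonoid.Sum +-0-commutativeMonoid
  using (sum; sum-cong-≗; sum-permute)

open ≡-Reasoning

xor-cancelˡ : ∀ x {y z} → x xor y ≡ x xor z → y ≡ z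
xor-cancelˡ false e = e
xor-cancelˡ true  e = not-injective e

xor-cancelʳ : ∀ {x y} z → x xor z ≡ y xor z → x ≡ y
xor-cancelʳ {x} {y} z e = xor-cancelˡ z (trans (xor-comm z x) (trans e (xor-comm y z)))

module _ {V : Set} {E : Rel V 0ℓ} where

  mkAut : (σ : V ↔ V) →
          (∀ x y → E x y → E (Inverse.to σ x) (Inverse.to σ y)) →
          (∀ x y → E x y → E (Inverse.from σ x) (Inverse.from σ y)) → Aut E
  mkAut σ to-hom from-hom = σ , λ x y → mk⇔ (to-hom x y) λ e →
    subst₂ E (Inverse.strictlyInverseʳ σ x) (Inverse.strictlyInverseʳ σ y) (from-hom _ _ e)

  Aut-from-hom : (σ : Aut E) → ∀ x y → E x y →
                 E (Inverse.from (proj₁ σ) x) (Inverse.from (proj₁ σ) y)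
  Aut-from-hom (σ , hom) x y e = Equivalence.from (hom _ _)
    (subst₂ E (sym (Inverse.strictlyInverseˡ σ x)) (sym (Inverse.strictlyInverseˡ σ y)) e)

  _∘ᴬ_ : Aut E → Aut E → Aut E
  (σ , σ-hom) ∘ᴬ (τ , τ-hom) =
    σ ↔-∘ τ , λ x y → σ-hom (Inverse.to τ x) (Inverse.to τ y) ⇔-∘ τ-hom x y

indicator : Bool → ℕ
indicator b = if b then 1 else 0

∣p∣≡sum : ∀ {n} (p : Subset n) → ∣ p ∣ ≡ sum (λ i → indicator (lookup p i))
∣p∣≡sum []            = refl
∣p∣≡sum (inside  ∷ p) = cong suc (∣p∣≡sum p)
∣p∣≡sum (outside ∷ p) = ∣p∣≡sum p

lookup-⁅⁆ : ∀ {n} (i j : Fin n) → lookup ⁅ i ⁆ j ≡ does (j ≟ i)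
lookup-⁅⁆ zero    zero    = refl
lookup-⁅⁆ zero    (suc j) = lookup-replicate j outside
lookup-⁅⁆ (suc i) zero    = refl
lookup-⁅⁆ (suc i) (suc j) = lookup-⁅⁆ i j

∁-involutive : ∀ {n} (p : Subset n) → ∁ (∁ p) ≡ p
∁-involutive p = trans (sym (map-∘ not not p)) (trans (map-cong not-involutive p) (map-id p))

∁-△ : ∀ {n} (p q : Subset n) → ∁ p △ ∁ q ≡ p △ q
∁-△ []      []      = refl
∁-△ (x ∷ p) (y ∷ q) = cong₂ _∷_ (xor-annihilates-not x y) (∁-△ p q)

∣∁p∣≡m : ∀ m (p : Subset (2 * m)) → ∣ p ∣ ≡ m → ∣ ∁ p ∣ ≡ m
∣∁p∣≡m m p ∣p∣≡m = begin
  ∣ ∁ p ∣           ≡⟨ ∣∁p∣≡n∸∣p∣ p ⟩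
  2 * m ∸ ∣ p ∣     ≡⟨ cong (2 * m ∸_) ∣p∣≡m ⟩
  m + (m + 0) ∸ m   ≡⟨ m+n∸m≡n m (m + 0) ⟩
  m + 0             ≡⟨ +-identityʳ m ⟩
  m                 ∎

initial : ∀ {n} j → j ≤ n → Subset n
initial zero    _         = ⊥
initial (suc j) (s≤s j≤n) = inside ∷ initial j j≤n

∣initial∣ : ∀ {n} j (j≤n : j ≤ n) → ∣ initial j j≤n ∣ ≡ j
∣initial∣ {n} zero _         = ∣⊥∣≡0 n
∣initial∣ (suc j) (s≤s j≤n) = cong suc (∣initial∣ j j≤n)

image : ∀ {n} → Permutation′ n → Subset n → Subset n
image σ p = tabulate (λ i → lookup p (σ ⟨$⟩ˡ i))

module _ {n} (σ : Permutation′ n) where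

  lookup-image : ∀ p i → lookup (image σ p) i ≡ lookup p (σ ⟨$⟩ˡ i)
  lookup-image p i = lookup∘tabulate _ i

  lookup-image-⟨$⟩ʳ : ∀ p i → lookup (image σ p) (σ ⟨$⟩ʳ i) ≡ lookup p i
  lookup-image-⟨$⟩ʳ p i = trans (lookup-image p (σ ⟨$⟩ʳ i)) (cong (lookup p) (inverseˡ σ))

  image-zipWith : ∀ (f : Bool → Bool → Bool) p q →
                  image σ (zipWith f p q) ≡ zipWith f (image σ p) (image σ q)
  image-zipWith f p q = Pointwise-≡⇒≡ (ext λ i → begin
    lookup (image σ (zipWith f p q)) i                 ≡⟨ lookup-image (zipWith f p q) i ⟩
    lookup (zipWith f p q) (σ ⟨$⟩ˡ i)                  ≡⟨ lookup-zipWith f (σ ⟨$⟩ˡ i) p q ⟩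
    f (lookup p (σ ⟨$⟩ˡ i)) (lookup q (σ ⟨$⟩ˡ i))      ≡⟨ cong₂ f (lookup-image p i) (lookup-image q i) ⟨
    f (lookup (image σ p) i) (lookup (image σ q) i)    ≡⟨ lookup-zipWith f i (image σ p) (image σ q) ⟨
    lookup (zipWith f (image σ p) (image σ q)) i       ∎)

  image-⁅⁆ : ∀ i → image σ ⁅ i ⁆ ≡ ⁅ σ ⟨$⟩ʳ i ⁆
  image-⁅⁆ i = Pointwise-≡⇒≡ (ext λ j → begin
    lookup (image σ ⁅ i ⁆) j       ≡⟨ lookup-image ⁅ i ⁆ j ⟩
    lookup ⁅ i ⁆ (σ ⟨$⟩ˡ j)        ≡⟨ lookup-⁅⁆ i (σ ⟨$⟩ˡ j) ⟩
    does (σ ⟨$⟩ˡ j ≟ i)            ≡⟨ does-⇔ (mk⇔ (moveʳ {j}) (moveˡ {j})) (σ ⟨$⟩ˡ j ≟ i) (j ≟ σ ⟨$⟩ʳ i) ⟩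
    does (j ≟ σ ⟨$⟩ʳ i)            ≡⟨ lookup-⁅⁆ (σ ⟨$⟩ʳ i) j ⟨
    lookup ⁅ σ ⟨$⟩ʳ i ⁆ j          ∎)
    where
    moveʳ : ∀ {j} → σ ⟨$⟩ˡ j ≡ i → j ≡ σ ⟨$⟩ʳ i
    moveʳ e = trans (sym (inverseʳ σ)) (cong (σ ⟨$⟩ʳ_) e)
    moveˡ : ∀ {j} → j ≡ σ ⟨$⟩ʳ i → σ ⟨$⟩ˡ j ≡ i
    moveˡ e = trans (cong (σ ⟨$⟩ˡ_) e) (inverseˡ σ)

  image-flip-image : ∀ p → image (flip σ) (image σ p) ≡ p
  image-flip-image p = Pointwise-≡⇒≡ (ext λ i →
    trans (lookup∘tabulate _ i) (lookup-image-⟨$⟩ʳ p i))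

  ∣image∣ : ∀ p → ∣ image σ p ∣ ≡ ∣ p ∣
  ∣image∣ p = begin
    ∣ image σ p ∣                                        ≡⟨ ∣p∣≡sum (image σ p) ⟩
    sum (λ i → indicator (lookup (image σ p) i))        ≡⟨ sum-cong-≗ (λ i → cong indicator (lookup-image p i)) ⟩
    sum (λ i → indicator (lookup p (σ ⟨$⟩ˡ i)))         ≡⟨ sum-permute (λ i → indicator (lookup p i)) (flip σ) ⟨
    sum (λ i → indicator (lookup p i))                  ≡⟨ ∣p∣≡sum p ⟨
    ∣ p ∣                                                ∎

sendFirstTwoTo : ∀ {n} {x y : Fin (suc (suc n))} → x ≢ y →
                 Σ (Permutation′ (suc (suc n))) λ π → π ⟨$⟩ʳ 0F ≡ x × π ⟨$⟩ʳ 1F ≡ y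
sendFirstTwoTo {x = x} {y} x≢y =
  π , refl , trans (insert-punchIn 0F x ρ 0F) (punchIn-punchOut x≢y)
  where
  ρ = insert 0F (punchOut x≢y) id
  π = insert 0F x ρ

xor-lookup-injective : ∀ {m n} → 2 ≤ m → m < n → ∀ b c (x y : Fin n) →
  (∀ p → ∣ p ∣ ≡ m → b xor lookup p x ≡ c xor lookup p y) → b ≡ c × x ≡ y
xor-lookup-injective {suc (suc k)} {suc (suc n)} (s≤s (s≤s z≤n)) (s≤s (s≤s k<n)) b c x y agree = b≡c , x≡y
  where
  bothIn firstIn : Subset (suc (suc n))
  bothIn  = inside ∷ inside  ∷ initial k (<⇒≤ k<n)
  firstIn = inside ∷ outside ∷ initial (suc k) k<n

  ∣bothIn∣ : ∣ bothIn ∣ ≡ suc (suc k)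
  ∣bothIn∣ = cong (λ j → suc (suc j)) (∣initial∣ k (<⇒≤ k<n))

  ∣firstIn∣ : ∣ firstIn ∣ ≡ suc (suc k)
  ∣firstIn∣ = cong suc (∣initial∣ (suc k) k<n)

  x≡y : x ≡ y
  x≡y with x ≟ y
  ... | yes x≡y = x≡y
  -- Transported along π, bothIn and firstIn give b xor true ≡ c xor true and b xor true ≡ c xor false.
  ... | no  x≢y = contradiction
    (xor-cancelˡ c (trans (sym (agreeAt01 bothIn ∣bothIn∣)) (agreeAt01 firstIn ∣firstIn∣))) λ ()
    where
    π = proj₁ (sendFirstTwoTo x≢y)
    π0≡x = proj₁ (proj₂ (sendFirstTwoTo x≢y))
    π1≡y = proj₂ (proj₂ (sendFirstTwoTo x≢y))
    agreeAt01 : ∀ p → ∣ p ∣ ≡ suc (suc k) → b xor lookup p 0F ≡ c xor lookup p 1F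
    agreeAt01 p ∣p∣ = begin
      b xor lookup p 0F                        ≡⟨ cong (b xor_) (lookup-image-⟨$⟩ʳ π p 0F) ⟨
      b xor lookup (image π p) (π ⟨$⟩ʳ 0F)     ≡⟨ cong (λ z → b xor lookup (image π p) z) π0≡x ⟩
      b xor lookup (image π p) x               ≡⟨ agree (image π p) (trans (∣image∣ π p) ∣p∣) ⟩
      c xor lookup (image π p) y               ≡⟨ cong (λ z → c xor lookup (image π p) z) π1≡y ⟨
      c xor lookup (image π p) (π ⟨$⟩ʳ 1F)     ≡⟨ cong (c xor_) (lookup-image-⟨$⟩ʳ π p 1F) ⟩
      c xor lookup p 1F                        ∎

  b≡c : b ≡ c
  b≡c = xor-cancelʳ _ (subst (λ z → b xor lookup bothIn x ≡ c xor lookup bothIn z) (sym x≡y)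
                              (agree bothIn ∣bothIn∣))

tokenVertex-≡ : ∀ {n k} {X Y : TokenVertex n k} → proj₁ X ≡ proj₁ Y → X ≡ Y
tokenVertex-≡ {X = p , ∣p∣} {.p , ∣p∣′} refl = cong (p ,_) (≡-irrelevant ∣p∣ ∣p∣′)

imageᵗ : ∀ {n k} → Permutation′ n → TokenVertex n k → TokenVertex n k
imageᵗ σ (p , ∣p∣) = image σ p , trans (∣image∣ σ p) ∣p∣

imageᵗ-↔ : ∀ {n k} → Permutation′ n → TokenVertex n k ↔ TokenVertex n k
imageᵗ-↔ σ = mk↔ₛ′ (imageᵗ σ) (imageᵗ (flip σ))
  (λ X → tokenVertex-≡ (image-flip-image (flip σ) (proj₁ X)))
  (λ X → tokenVertex-≡ (image-flip-image σ (proj₁ X)))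

module _ {n} (Γ : GraphOfOrder n) (k : ℕ) where
  open Graph Γ using (Adj)

  image-preserves-TokenAdj : (σ : Permutation′ n) →
    (∀ i j → Adj i j → Adj (σ ⟨$⟩ʳ i) (σ ⟨$⟩ʳ j)) →
    ∀ X Y → TokenAdj Γ k X Y → TokenAdj Γ k (imageᵗ σ X) (imageᵗ σ Y)
  image-preserves-TokenAdj σ hom (p , _) (q , _) (i , j , ij , p△q≡ij) =
    σ ⟨$⟩ʳ i , σ ⟨$⟩ʳ j , hom i j ij , (begin
      image σ p △ image σ q          ≡⟨ image-zipWith σ _xor_ p q ⟨
      image σ (p △ q)                ≡⟨ cong (image σ) p△q≡ij ⟩
      image σ (⁅ i ⁆ ∪ ⁅ j ⁆)        ≡⟨ image-zipWith σ _∨_ ⁅ i ⁆ ⁅ j ⁆ ⟩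
      image σ ⁅ i ⁆ ∪ image σ ⁅ j ⁆  ≡⟨ cong₂ _∪_ (image-⁅⁆ σ i) (image-⁅⁆ σ j) ⟩
      ⁅ σ ⟨$⟩ʳ i ⁆ ∪ ⁅ σ ⟨$⟩ʳ j ⁆    ∎)

  inducedAut : Aut Adj → Aut (TokenAdj Γ k)
  inducedAut σ = mkAut (imageᵗ-↔ (proj₁ σ))
    (image-preserves-TokenAdj (proj₁ σ) (λ i j → Equivalence.to (proj₂ σ i j)))
    (image-preserves-TokenAdj (flip (proj₁ σ)) (Aut-from-hom σ))

module _ {m} (Γ : GraphOfOrder (2 * m)) where

  ∁ᵗ : TokenVertex (2 * m) m → TokenVertex (2 * m) m
  ∁ᵗ (p , ∣p∣) = ∁ p , ∣∁p∣≡m m p ∣p∣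

  ∁ᵗ-involutive : ∀ X → ∁ᵗ (∁ᵗ X) ≡ X
  ∁ᵗ-involutive X = tokenVertex-≡ (∁-involutive (proj₁ X))

  ∁-preserves-TokenAdj : ∀ X Y → TokenAdj Γ m X Y → TokenAdj Γ m (∁ᵗ X) (∁ᵗ Y)
  ∁-preserves-TokenAdj (p , _) (q , _) (i , j , ij , p△q≡ij) = i , j , ij , trans (∁-△ p q) p△q≡ij

  complementAut : Aut (TokenAdj Γ m)
  complementAut = mkAut (mk↔ₛ′ ∁ᵗ ∁ᵗ ∁ᵗ-involutive ∁ᵗ-involutive)
    ∁-preserves-TokenAdj ∁-preserves-TokenAdj

  tokenAut : Bool → Aut (Graph.Adj Γ) → Aut (TokenAdj Γ m)
  tokenAut false σ = inducedAut Γ m σ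
  tokenAut true  σ = complementAut ∘ᴬ inducedAut Γ m σ

  lookup-tokenAut : ∀ b σ X i →
    lookup (proj₁ (Inverse.to (proj₁ (tokenAut b σ)) X)) i ≡ b xor lookup (proj₁ X) (proj₁ σ ⟨$⟩ˡ i)
  lookup-tokenAut false σ X i = lookup-image (proj₁ σ) (proj₁ X) i
  lookup-tokenAut true  σ X i =
    trans (lookup-map i not (image (proj₁ σ) (proj₁ X))) (cong not (lookup-image (proj₁ σ) (proj₁ X) i))

tokenAut-injective : ∀ {m} (Γ : GraphOfOrder (2 * m)) → 2 ≤ m → ∀ b c σ τ →
  SameAut (TokenAdj Γ m) (tokenAut Γ b σ) (tokenAut Γ c τ) → b ≡ c × SameAut (Graph.Adj Γ) σ τ
tokenAut-injective {m@(suc (suc _))} Γ 2≤m@(s≤s (s≤s z≤n)) b c (σ , σ-hom) (τ , τ-hom) same =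
  proj₁ (rigid 0F) , λ x → sym (trans (cong (τ ⟨$⟩ʳ_) (proj₂ (rigid x))) (inverseʳ τ))
  where
  agree : ∀ X i → b xor lookup (proj₁ X) (σ ⟨$⟩ˡ i) ≡ c xor lookup (proj₁ X) (τ ⟨$⟩ˡ i)
  agree X i = begin
    b xor lookup (proj₁ X) (σ ⟨$⟩ˡ i)                         ≡⟨ lookup-tokenAut Γ b (σ , σ-hom) X i ⟨
    lookup (proj₁ (Inverse.to (proj₁ (tokenAut Γ b (σ , σ-hom))) X)) i ≡⟨ cong (λ Y → lookup (proj₁ Y) i) (same X) ⟩
    lookup (proj₁ (Inverse.to (proj₁ (tokenAut Γ c (τ , τ-hom))) X)) i ≡⟨ lookup-tokenAut Γ c (τ , τ-hom) X i ⟩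
    c xor lookup (proj₁ X) (τ ⟨$⟩ˡ i)                         ∎

  rigid : ∀ x → b ≡ c × x ≡ τ ⟨$⟩ˡ (σ ⟨$⟩ʳ x)
  rigid x = xor-lookup-injective 2≤m (m<m+n m (s≤s z≤n)) b c x _ λ p ∣p∣ →
    subst (λ z → b xor lookup p z ≡ c xor lookup p (τ ⟨$⟩ˡ (σ ⟨$⟩ʳ x))) (inverseˡ σ)
          (agree (p , ∣p∣) (σ ⟨$⟩ʳ x))

mainTheorem4 : (m : ℕ) → 2 ≤ m → (Γ : GraphOfOrder (2 * m)) →
    AtLeastTwice (TokenAdj Γ m) (Graph.Adj Γ)
mainTheorem4 m 2≤m Γ = (λ (b , σ) → tokenAut Γ b σ) , tokenAut-injective Γ 2≤m
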